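{- The deterministic query complexity of deciding whether an $n$-vertex directed graph contains a king is $\Theta(n^2)$; that is, $\mathsf{D}(\textsf{EXIST-KING}_n)=\Theta(n^2)$ for general digraphs.
   Context: A king in a directed graph is a vertex $v$ such that for every other vertex $u\neq v$, either $v\to u$ is an edge or there is a vertex $w$ with $v\to w$ and $w\to u$ edges. An $n$-vertex digraph on vertex set $\{0,\dots,n-1\}$ is given as a string in $\{0,1\}^{n^2}$, one bit per ordered pair indicating presence of that directed edge. $\textsf{EXIST-KING}_n$ asks to output $1$ if the input digraph contains a king and $0$ otherwise. $\mathsf{D}(f)$ is the minimum depth of a deterministic decision tree (which adaptively queries input bits) that computes the correct answer on every input. -}

module Defs where

open import Data.Nat using (ℕ; zero; suc; _+_; _*_; _≤_; _⊔_)
open import Data.Fin using (Fin)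
open import Data.Bool using (Bool; true; false; if_then_else_)
open import Data.Product using (_×_; _,_; ∃; ∃-syntax)
open import Data.Sum using (_⊎_)
open import Relation.Binary.PropositionalEquality using (_≡_; _≢_)

Digraph : ℕ → Set
Digraph n = Fin n → Fin n → Bool

Bit : ℕ → Set
Bit n = Fin n × Fin n

King : ∀ {n} → Digraph n → Fin n → Set
King {n} G v = (u : Fin n) → u ≢ v →
  (G v u ≡ true) ⊎ (∃[ w ] (G v w ≡ true × G w u ≡ true))

HasKing : ∀ {n} → Digraph n → Set
HasKing {n} G = ∃[ v ] King G v

data DTree (I : Set) : Set where
  leaf : Bool → DTree I
  node : I → DTree I → DTree I → DTree I

depth : ∀ {I} → DTree I → ℕ
depth (leaf _) = 0
depth (node _ t₀ t₁) = suc (depth t₀ ⊔ depth t₁)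

eval : ∀ {I} → DTree I → (I → Bool) → Bool
eval (leaf b) x = b
eval (node i t₀ t₁) x = if x i then eval t₁ x else eval t₀ x

ComputesExistKing : (n : ℕ) → DTree (Bit n) → Set
ComputesExistKing n T = (G : Digraph n) →
  (eval T (λ { (u , v) → G u v }) ≡ true → HasKing G) ×
  (HasKing G → eval T (λ { (u , v) → G u v }) ≡ true)

D≤ : ℕ → ℕ → Set
D≤ n d = ∃[ T ] (ComputesExistKing n T × depth T ≤ d)

{-# OPTIONS --safe #-}
module Submission where

-- A tree querying all n² bits decides every property of the input, which gives the upper bound.
-- For the lower bound, split the vertices into halves L and R and let G₀ be the disjoint union
-- of the complete digraphs on L and on R. G₀ has no king, as no edge leaves a half, but adding
-- any single edge a → b with a ∈ L and b ∈ R makes a a king: a reaches L directly and R through b.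
-- So the |L|·|R| ≥ n²/9 bits (a , b) are all sensitive at G₀, and every correct decision tree
-- queries each of them on the path followed by G₀.

open import Defs
open import Data.Nat using (ℕ; _+_; _*_; _≤_; _<_; ⌊_/2⌋; ⌈_/2⌉; z≤n; s≤s; z<s)
open import Data.Nat.Properties
  using (≤-trans; ≤-reflexive; m≤n⊔m; m≤m⊔n; ⊔-lub; n≤1+n; +-monoˡ-≤; +-monoʳ-≤; *-monoʳ-≤; *-mono-≤;
         +-identityʳ; *-identityˡ; ⌊n/2⌋-mono; ⌊n/2⌋≤⌈n/2⌉; ⌊n/2⌋+⌈n/2⌉≡n; module ≤-Reasoning)
open import Data.Nat.Tactic.RingSolver using (solve-∀)
open import Data.Fin using (Fin; _↑ˡ_; _↑ʳ_; splitAt; remQuot; combine)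
open import Data.Fin.Properties as Fin
  using (any?; all?; injective⇒≤; ↑ˡ-injective; ↑ʳ-injective; splitAt-↑ˡ; splitAt-↑ʳ;
         combine-remQuot; remQuot-combine)
open import Data.Bool using (Bool; true; false; if_then_else_)
open import Data.Bool.Properties as Bool using (¬-not)
open import Data.Product using (_×_; ∃-syntax; _,_; proj₁; proj₂; curry; uncurry; map; map₂)
open import Data.Product.Properties using (≡-dec; ,-injectiveˡ; ,-injectiveʳ)
open import Data.Sum as Sum using (_⊎_; inj₁; inj₂; [_,_]′)
open import Data.List using (List; []; _∷_; length; lookup; tabulate)
open import Data.List.Properties using (length-tabulate)
open import Data.List.Relation.Unary.Any using (here; there; index)
open import Data.List.Relation.Unary.Any.Properties using (lookup-index)
open import Data.List.Membership.Propositional using (_∈_; _∉_)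
open import Data.List.Membership.Propositional.Properties using (∈-tabulate⁺)
open import Function using (_∘_; const)
open import Function.Bundles using (mk⇔)
open import Function.Definitions using (Injective)
open import Relation.Nullary using (¬_; Dec; yes; no; does; contradiction)
open import Relation.Nullary.Decidable using (_×-dec_; _⊎-dec_; _→-dec_; ¬?; dec-true; dec-false; does-⇔)
open import Relation.Binary using (DecidableEquality)
open import Relation.Binary.PropositionalEquality
  using (_≡_; _≢_; _≗_; refl; sym; trans; cong; cong₂; subst; subst₂; ≢-sym; module ≡-Reasoning)

does-true⇒ : ∀ {A : Set} (a? : Dec A) → does a? ≡ true → A
does-true⇒ (yes a) _ = a

path : ∀ {I} → DTree I → (I → Bool) → List I
path (leaf _)       x = []
path (node i t₀ t₁) x = i ∷ (if x i then path t₁ x else path t₀ x)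

length-path≤depth : ∀ {I} (T : DTree I) x → length (path T x) ≤ depth T
length-path≤depth (leaf _)       x = z≤n
length-path≤depth (node i t₀ t₁) x with x i
... | true  = s≤s (≤-trans (length-path≤depth t₁ x) (m≤n⊔m (depth t₀) (depth t₁)))
... | false = s≤s (≤-trans (length-path≤depth t₀ x) (m≤m⊔n (depth t₀) (depth t₁)))

eval-path-agree : ∀ {I} (T : DTree I) x y → (∀ i → i ∈ path T x → x i ≡ y i) → eval T x ≡ eval T y
eval-path-agree (leaf _)       x y agree = refl
eval-path-agree (node i t₀ t₁) x y agree
  with x i | y i | agree i (here refl) | (λ j → agree j ∘ there)
... | true  | .true  | refl | agree-on-path = eval-path-agree t₁ x y agree-on-path
... | false | .false | refl | agree-on-path = eval-path-agree t₀ x y agree-on-path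

injection-into-list⇒≤length : ∀ {I : Set} {k} (L : List I) (h : Fin k → I) →
                              Injective _≡_ _≡_ h → (∀ a → h a ∈ L) → k ≤ length L
injection-into-list⇒≤length L h h-injective h∈L = injective⇒≤ position-injective
  where
    position-injective : Injective _≡_ _≡_ (index ∘ h∈L)
    position-injective {a} {c} same-position = h-injective (begin
      h a                        ≡⟨ lookup-index (h∈L a) ⟩
      lookup L (index (h∈L a))   ≡⟨ cong (lookup L) same-position ⟩
      lookup L (index (h∈L c))   ≡⟨ lookup-index (h∈L c) ⟨
      h c                        ∎)
      where open ≡-Reasoning

module WithDecidableEquality {I : Set} (_≟_ : DecidableEquality I) where
  open import Data.List.Membership.DecPropositional _≟_ using (_∈?_)

  _[_≔_] : (I → Bool) → I → Bool → (I → Bool)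
  (x [ i ≔ b ]) j = if does (j ≟ i) then b else x j

  update-≡ : ∀ x i b → (x [ i ≔ b ]) i ≡ b
  update-≡ x i b rewrite dec-true (i ≟ i) refl = refl

  update-≢ : ∀ x {i j} b → j ≢ i → (x [ i ≔ b ]) j ≡ x j
  update-≢ x {i} {j} b j≢i rewrite dec-false (j ≟ i) j≢i = refl

  sensitive∈path : ∀ (T : DTree I) x y i → (∀ j → j ≢ i → x j ≡ y j) →
                   eval T y ≢ eval T x → i ∈ path T x
  sensitive∈path T x y i agree-off-i differ with i ∈? path T x
  ... | yes i∈path = i∈path
  ... | no  i∉path = contradiction (sym (eval-path-agree T x y agree-on-path)) differ
    where
      agree-on-path : ∀ j → j ∈ path T x → x j ≡ y j
      agree-on-path j j∈path = agree-off-i j (λ { refl → i∉path j∈path })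

  sensitivity≤depth : ∀ {k} (T : DTree I) x (h : Fin k → I) → Injective _≡_ _≡_ h →
                      (∀ a → ∃[ y ] ((∀ j → j ≢ h a → x j ≡ y j) × eval T y ≢ eval T x)) →
                      k ≤ depth T
  sensitivity≤depth T x h h-injective sensitive =
    ≤-trans (injection-into-list⇒≤length (path T x) h h-injective h∈path) (length-path≤depth T x)
    where
      h∈path : ∀ a → h a ∈ path T x
      h∈path a = let (y , agree , differ) = sensitive a in sensitive∈path T x y (h a) agree differ

  queryAll : List I → ((I → Bool) → Bool) → (I → Bool) → DTree I
  queryAll []      f ρ = leaf (f ρ)
  queryAll (i ∷ L) f ρ = node i (queryAll L f (ρ [ i ≔ false ])) (queryAll L f (ρ [ i ≔ true ]))

  depth-queryAll : ∀ L f ρ → depth (queryAll L f ρ) ≤ length L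
  depth-queryAll []      f ρ = z≤n
  depth-queryAll (i ∷ L) f ρ = s≤s (⊔-lub (depth-queryAll L f _) (depth-queryAll L f _))

  update-agreeing : ∀ {L ρ i} (x : I → Bool) b → x i ≡ b → (∀ j → j ∉ i ∷ L → ρ j ≡ x j) →
                    ∀ j → j ∉ L → (ρ [ i ≔ b ]) j ≡ x j
  update-agreeing {i = i} x b xi≡b agree j j∉L with j ≟ i
  ... | yes refl = sym xi≡b
  ... | no  j≢i  = agree j λ { (here j≡i) → j≢i j≡i ; (there j∈L) → j∉L j∈L }

  eval-queryAll : ∀ L f → (∀ {x y} → x ≗ y → f x ≡ f y) →
                  ∀ ρ x → (∀ j → j ∉ L → ρ j ≡ x j) → eval (queryAll L f ρ) x ≡ f x
  eval-queryAll []      f f-resp ρ x agree = f-resp (λ j → agree j λ ())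
  eval-queryAll (i ∷ L) f f-resp ρ x agree with x i in xi
  ... | true  = eval-queryAll L f f-resp _ x (update-agreeing x true xi agree)
  ... | false = eval-queryAll L f f-resp _ x (update-agreeing x false xi agree)

  decisionTree : ∀ {P : (I → Bool) → Set} (L : List I) → (∀ i → i ∈ L) →
                 (P? : ∀ x → Dec (P x)) → (∀ {x y} → x ≗ y → P x → P y) →
                 ∃[ T ] ((∀ x → eval T x ≡ does (P? x)) × depth T ≤ length L)
  decisionTree L complete P? P-resp =
      queryAll L (does ∘ P?) (const false)
    , (λ x → eval-queryAll L (does ∘ P?) does-resp _ x (λ j j∉L → contradiction (complete j) j∉L))
    , depth-queryAll L _ _
    where
      does-resp : ∀ {x y} → x ≗ y → does (P? x) ≡ does (P? y)
      does-resp x≗y = does-⇔ (mk⇔ (P-resp x≗y) (P-resp (sym ∘ x≗y))) (P? _) (P? _)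

bit-≟ : ∀ {n} → DecidableEquality (Bit n)
bit-≟ = ≡-dec Fin._≟_ Fin._≟_

module BitQueries {n : ℕ} = WithDecidableEquality (bit-≟ {n})
open BitQueries

hasKing? : ∀ {n} (G : Digraph n) → Dec (HasKing G)
hasKing? G = any? λ v → all? λ u → ¬? (u Fin.≟ v) →-dec
  ((G v u Bool.≟ true) ⊎-dec any? λ w → (G v w Bool.≟ true) ×-dec (G w u Bool.≟ true))

hasKing-resp : ∀ {n} {G H : Digraph n} → uncurry G ≗ uncurry H → HasKing G → HasKing H
hasKing-resp {G = G} {H} G≗H (v , king) =
  v , λ u u≢v → Sum.map (transport _) (map₂ (map (transport _) (transport _))) (king u u≢v)
  where
    transport : ∀ e → uncurry G e ≡ true → uncurry H e ≡ true
    transport e = trans (sym (G≗H e))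

bits : (n : ℕ) → List (Bit n)
bits n = tabulate (remQuot {n} n)

∈-bits : ∀ {n} (e : Bit n) → e ∈ bits n
∈-bits (u , v) = subst (_∈ bits _) (remQuot-combine u v) (∈-tabulate⁺ (combine u v))

existKing-upperBound : ∀ n → D≤ n (n * n)
existKing-upperBound n =
  let (T , eval-T , depth-T) = decisionTree (bits n) ∈-bits (hasKing? ∘ curry) hasKing-resp
  in T
   , (λ G → does-true⇒ (hasKing? G) ∘ trans (sym (eval-T (uncurry G)))
          , trans (eval-T (uncurry G)) ∘ dec-true (hasKing? G))
   , ≤-trans depth-T (≤-reflexive (length-tabulate (remQuot {n} n)))

addEdge : ∀ {n} → Digraph n → Fin n → Fin n → Digraph n
addEdge G a b = curry (uncurry G [ (a , b) ≔ true ])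

module TwoCliques {n} (colour : Fin n → Bool) where

  twoCliques : Digraph n
  twoCliques u v = does (colour u Bool.≟ colour v)

  edge⇒sameColour : ∀ {u v} → twoCliques u v ≡ true → colour u ≡ colour v
  edge⇒sameColour {u} {v} = does-true⇒ (colour u Bool.≟ colour v)

  sameColour⇒edge : ∀ {u v} → colour u ≡ colour v → twoCliques u v ≡ true
  sameColour⇒edge {u} {v} = dec-true (colour u Bool.≟ colour v)

  king⇒monochromatic : ∀ {v} → King twoCliques v → ∀ u → colour v ≡ colour u
  king⇒monochromatic {v} king u with u Fin.≟ v
  ... | yes refl = refl
  ... | no  u≢v with king u u≢v
  ...   | inj₁ vu             = edge⇒sameColour vu
  ...   | inj₂ (w , vw , wu) = trans (edge⇒sameColour vw) (edge⇒sameColour wu)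

  twoCliques-noKing : ∀ {a b} → colour a ≢ colour b → ¬ HasKing twoCliques
  twoCliques-noKing {a} {b} a≁b (v , king) =
    a≁b (trans (sym (king⇒monochromatic king a)) (king⇒monochromatic king b))

  addEdge-king : ∀ {a b} → colour a ≢ colour b → King (addEdge twoCliques a b) a
  addEdge-king {a} {b} a≁b u u≢a with u Fin.≟ b
  ... | yes refl = inj₁ (update-≡ (uncurry twoCliques) (a , u) true)
  ... | no  u≢b with colour u Bool.≟ colour a
  ...   | yes u∼a = inj₁ (trans (update-≢ (uncurry twoCliques) true (u≢b ∘ ,-injectiveʳ))
                               (sameColour⇒edge (sym u∼a)))
  ...   | no  u≁a = inj₂ (b , update-≡ (uncurry twoCliques) (a , b) true
                         , trans (update-≢ (uncurry twoCliques) true (b≢a ∘ ,-injectiveˡ))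
                                 (sameColour⇒edge b∼u))
    where
      b≢a : b ≢ a
      b≢a b≡a = a≁b (cong colour (sym b≡a))
      b∼u : colour b ≡ colour u
      b∼u = trans (¬-not (≢-sym a≁b)) (sym (¬-not u≁a))

existKing-lowerBound : ∀ m r (T : DTree (Bit (m + r))) → ComputesExistKing (m + r) T → m * r ≤ depth T
existKing-lowerBound m r T computes =
  sensitivity≤depth T (uncurry twoCliques) crossBit crossBit-injective addEdge-changes-answer
  where
    isLeftOfSplit : Fin m ⊎ Fin r → Bool
    isLeftOfSplit = [ const true , const false ]′

    isLeft : Fin (m + r) → Bool
    isLeft = isLeftOfSplit ∘ splitAt m
    open TwoCliques isLeft

    crossBit : Fin (m * r) → Bit (m + r)
    crossBit = map (_↑ˡ r) (m ↑ʳ_) ∘ remQuot {m} r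

    crossBit-injective : Injective _≡_ _≡_ crossBit
    crossBit-injective {k} {k′} same = begin
      k                                    ≡⟨ combine-remQuot {m} r k ⟨
      uncurry combine (remQuot {m} r k)    ≡⟨ cong (uncurry combine) (cong₂ _,_ same-row same-column) ⟩
      uncurry combine (remQuot {m} r k′)   ≡⟨ combine-remQuot {m} r k′ ⟩
      k′                                   ∎
      where
        open ≡-Reasoning
        same-row = ↑ˡ-injective r _ _ (,-injectiveˡ same)
        same-column = ↑ʳ-injective m _ _ (,-injectiveʳ same)

    crossBit-bichromatic : ∀ k → isLeft (proj₁ (crossBit k)) ≢ isLeft (proj₂ (crossBit k))
    crossBit-bichromatic k =
      subst₂ _≢_ (sym (cong isLeftOfSplit (splitAt-↑ˡ m (proj₁ (remQuot {m} r k)) r)))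
                 (sym (cong isLeftOfSplit (splitAt-↑ʳ m r (proj₂ (remQuot {m} r k))))) (λ ())

    addEdge-changes-answer : ∀ k → ∃[ y ] ((∀ j → j ≢ crossBit k → uncurry twoCliques j ≡ y j) ×
                                           eval T y ≢ eval T (uncurry twoCliques))
    addEdge-changes-answer k =
        uncurry twoCliques [ crossBit k ≔ true ]
      , (λ j j≢crossBit → sym (update-≢ (uncurry twoCliques) true j≢crossBit))
      , λ same → twoCliques-noKing bichromatic (proj₁ (computes twoCliques) (trans (sym same) accepted))
      where
        a = proj₁ (crossBit k)
        b = proj₂ (crossBit k)
        bichromatic = crossBit-bichromatic k
        accepted : eval T (uncurry twoCliques [ crossBit k ≔ true ]) ≡ true
        accepted = proj₂ (computes (addEdge twoCliques a b)) (a , addEdge-king bichromatic)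

existKing-lowerBound-halves : ∀ n (T : DTree (Bit n)) → ComputesExistKing n T →
                              ⌊ n /2⌋ * ⌈ n /2⌉ ≤ depth T
existKing-lowerBound-halves n =
  subst (λ n′ → ∀ T → ComputesExistKing n′ T → ⌊ n /2⌋ * ⌈ n /2⌉ ≤ depth T)
        (⌊n/2⌋+⌈n/2⌉≡n n) (existKing-lowerBound ⌊ n /2⌋ ⌈ n /2⌉)

n≤3*⌊n/2⌋ : ∀ {n} → 2 ≤ n → n ≤ 3 * ⌊ n /2⌋
n≤3*⌊n/2⌋ {n} 2≤n = begin
  n                                    ≡⟨ ⌊n/2⌋+⌈n/2⌉≡n n ⟨
  -- ⌈ n /2⌉ unfolds to ⌊ 1 + n /2⌋ and ⌊ 2 + n /2⌋ to 1 + ⌊ n /2⌋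
  ⌊ n /2⌋ + ⌈ n /2⌉                    ≤⟨ +-monoʳ-≤ ⌊ n /2⌋ (⌊n/2⌋-mono (n≤1+n (1 + n))) ⟩
  ⌊ n /2⌋ + (1 + ⌊ n /2⌋)              ≤⟨ +-monoʳ-≤ ⌊ n /2⌋ (+-monoˡ-≤ ⌊ n /2⌋ (⌊n/2⌋-mono 2≤n)) ⟩
  ⌊ n /2⌋ + (⌊ n /2⌋ + ⌊ n /2⌋)        ≡⟨ cong (λ k → ⌊ n /2⌋ + (⌊ n /2⌋ + k)) (+-identityʳ ⌊ n /2⌋) ⟨
  3 * ⌊ n /2⌋                          ∎
  where open ≤-Reasoning

square≤9*⌊n/2⌋*⌈n/2⌉ : ∀ {n} → 2 ≤ n → n * n ≤ 9 * (⌊ n /2⌋ * ⌈ n /2⌉)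
square≤9*⌊n/2⌋*⌈n/2⌉ {n} 2≤n = begin
  n * n                                ≤⟨ *-mono-≤ n≤3⌊n/2⌋ (≤-trans n≤3⌊n/2⌋ (*-monoʳ-≤ 3 (⌊n/2⌋≤⌈n/2⌉ n))) ⟩
  (3 * ⌊ n /2⌋) * (3 * ⌈ n /2⌉)        ≡⟨ reassociate ⌊ n /2⌋ ⌈ n /2⌉ ⟩
  9 * (⌊ n /2⌋ * ⌈ n /2⌉)              ∎
  where
    open ≤-Reasoning
    n≤3⌊n/2⌋ = n≤3*⌊n/2⌋ 2≤n
    reassociate : ∀ a b → (3 * a) * (3 * b) ≡ 9 * (a * b)
    reassociate = solve-∀

corollary4p3 :
    (∃[ C ] ∃[ N ] ((n : ℕ) → N ≤ n → D≤ n (C * (n * n)))) ×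
    (∃[ p ] ∃[ q ] (0 < p × 0 < q × ∃[ N ] ((n : ℕ) → N ≤ n →
        (T : DTree (Bit n)) → ComputesExistKing n T → p * (n * n) ≤ q * depth T)))
corollary4p3 =
    (1 , 0 , λ n _ → subst (D≤ n) (sym (*-identityˡ (n * n))) (existKing-upperBound n))
  , (1 , 9 , z<s , z<s , 2 , λ n 2≤n T computes → begin
      1 * (n * n)                  ≡⟨ *-identityˡ (n * n) ⟩
      n * n                        ≤⟨ square≤9*⌊n/2⌋*⌈n/2⌉ 2≤n ⟩
      9 * (⌊ n /2⌋ * ⌈ n /2⌉)      ≤⟨ *-monoʳ-≤ 9 (existKing-lowerBound-halves n T computes) ⟩
      9 * depth T                  ∎)
  where open ≤-Reasoning
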